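{- For all combinators $u,v$: $u\equiv v$ if and only if $u\approx v$.
   Context: Combinators: $C ::= x \mid K \mid S \mid I \mid (C\ C)$ with $x$ ranging over variables; application associates to the left. $[x]u$ is defined by the first applicable rule: $[x]u=(K\ u)$ if $x\notin u$; $[x]x=I$; $[x](u\ x)=u$ if $x\notin u$; $[x](u\ v)=(S\ [x]u\ [x]v)$ otherwise. $\lambda x.u$ is defined by the first applicable rule: $\lambda x.u=(K\ u)$ if $x\notin u$; $\lambda x.x=I$; $\lambda x.(u\ v)=(S\ \lambda x.u\ \lambda x.v)$ otherwise. The strong reduction $\succ$ is the closure under application contexts of $(K\ u\ v)\succ u$, $(S\ u\ v\ w)\succ(u\ w\ (v\ w))$, $(I\ u)\succ u$, plus: $[x]u\succ[x]v$ whenever $u\succ v$. The reduction $\rightarrow$ is the closure under application contexts of $(K\ u\ v)\rightarrow u$, $(S\ u\ v\ w)\rightarrow(u\ w\ (v\ w))$, $(I\ u)\rightarrow u$, $(S\ (K\ u)\ (K\ v))\rightarrow(K\ (u\ v))$, $(S\ (K\ u)\ I)\rightarrow u$, plus: $\lambda x.u\rightarrow\lambda x.v$ whenever $u\rightarrow v$. $\equiv$ is the equivalence relation generated by $\succ$ (reflexive, symmetric, transitive closure) and $\approx$ the equivalence relation generated by $\rightarrow$. -}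

module Defs where

open import Data.Nat using (ℕ; _≡ᵇ_)
open import Data.Bool using (Bool; true; false; _∨_; _∧_; not)
open import Relation.Binary.Construct.Closure.Equivalence using (EqClosure)

infixl 9 _·_
data Comb : Set where
  var : ℕ → Comb
  K S I : Comb
  _·_ : Comb → Comb → Comb

occurs : ℕ → Comb → Bool
occurs x (var y) = x ≡ᵇ y
occurs x K = false
occurs x S = false
occurs x I = false
occurs x (u · v) = occurs x u ∨ occurs x v

isVar : ℕ → Comb → Bool
isVar x (var y) = x ≡ᵇ y
isVar x _ = false

[_]_ : ℕ → Comb → Comb
[ x ] u with occurs x u
... | false = K · u
[ x ] var y | true = I
[ x ] K | true = K · K
[ x ] S | true = K · S
[ x ] I | true = K · I
[ x ] (u · v) | true with isVar x v ∧ not (occurs x u)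
... | true = u
... | false = S · ([ x ] u) · ([ x ] v)

lam : ℕ → Comb → Comb
lam x u with occurs x u
... | false = K · u
lam x (var y) | true = I
lam x K | true = K · K
lam x S | true = K · S
lam x I | true = K · I
lam x (u · v) | true = S · lam x u · lam x v

infix 4 _≻_
data _≻_ : Comb → Comb → Set where
  redK  : ∀ {u v} → K · u · v ≻ u
  redS  : ∀ {u v w} → S · u · v · w ≻ u · w · (v · w)
  redI  : ∀ {u} → I · u ≻ u
  appL  : ∀ {u u' v} → u ≻ u' → u · v ≻ u' · v
  appR  : ∀ {u v v'} → v ≻ v' → u · v ≻ u · v'
  ξ     : ∀ {x u v} → u ≻ v → [ x ] u ≻ [ x ] v

infix 4 _⟶_
data _⟶_ : Comb → Comb → Set where
  redK  : ∀ {u v} → K · u · v ⟶ u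
  redS  : ∀ {u v w} → S · u · v · w ⟶ u · w · (v · w)
  redI  : ∀ {u} → I · u ⟶ u
  redSKK : ∀ {u v} → S · (K · u) · (K · v) ⟶ K · (u · v)
  redSKI : ∀ {u} → S · (K · u) · I ⟶ u
  appL  : ∀ {u u' v} → u ⟶ u' → u · v ⟶ u' · v
  appR  : ∀ {u v v'} → v ⟶ v' → u · v ⟶ u · v'
  ξ     : ∀ {x u v} → u ⟶ v → lam x u ⟶ lam x v

infix 4 _≣_ _≈_
_≣_ : Comb → Comb → Set
_≣_ = EqClosure _≻_

_≈_ : Comb → Comb → Set
_≈_ = EqClosure _⟶_

-- [x]u and λx.u differ only in the η-rule [x](t x) = t, whose counterpart on the λ side is
-- S (K t) I, and S (K t) I → t is one of the two extra rules of →. Hence in any congruence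
-- validating S (K t) I ~ t the two abstractions agree, so each ξ-rule is derivable from the
-- other. The extra rules of → are derivable for ≡ by strong reduction under [x] with x fresh:
-- S (K t) I = [x](K t x (I x)) ≻ [x](t x) = t, and likewise for S (K u) (K v).
module Submission where

open import Defs
open import Data.Bool using (true; false; _∧_; not)
open import Data.Bool.Properties using (∨-conicalˡ; ∨-conicalʳ)
open import Data.Nat using (ℕ; zero; suc; _⊔_; _<_; _≡ᵇ_; s≤s)
open import Data.Nat.Properties using (≤-trans; m≤m⊔n; m≤n⊔m; n<1+n)
open import Data.Product using (_×_; _,_)
open import Function.Bundles using (_⇔_; mk⇔)
open import Level using (0ℓ)
open import Relation.Binary.Core using (Rel)
open import Relation.Binary.PropositionalEquality using (_≡_; refl; sym; cong₂; module ≡-Reasoning)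
open import Relation.Binary.Construct.Closure.Equivalence as EqC
  using (EqClosure; gmap; return; _⋆)
open import Relation.Binary.Construct.Closure.ReflexiveTransitive using (ε; _◅◅_)
import Relation.Binary.Reasoning.Setoid as SetoidReasoning

≡ᵇ-refl : ∀ n → (n ≡ᵇ n) ≡ true
≡ᵇ-refl zero    = refl
≡ᵇ-refl (suc n) = ≡ᵇ-refl n

≡ᵇ-< : ∀ {m n} → m < n → (n ≡ᵇ m) ≡ false
≡ᵇ-< {zero}  {suc n} _       = refl
≡ᵇ-< {suc m} {suc n} (s≤s p) = ≡ᵇ-< p

∧-not-true : ∀ b c → b ∧ not c ≡ true → b ≡ true × c ≡ false
∧-not-true true false _ = refl , refl

maxVar : Comb → ℕ
maxVar (var y) = y
maxVar K       = 0
maxVar S       = 0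
maxVar I       = 0
maxVar (u · v) = maxVar u ⊔ maxVar v

occurs-> : ∀ u {x} → maxVar u < x → occurs x u ≡ false
occurs-> (var y) p = ≡ᵇ-< p
occurs-> K       p = refl
occurs-> S       p = refl
occurs-> I       p = refl
occurs-> (u · v) p
  rewrite occurs-> u (≤-trans (s≤s (m≤m⊔n (maxVar u) (maxVar v))) p)
        | occurs-> v (≤-trans (s≤s (m≤n⊔m (maxVar u) (maxVar v))) p) = refl

fresh : Comb → ℕ
fresh u = suc (maxVar u)

fresh-∉ : ∀ u → occurs (fresh u) u ≡ false
fresh-∉ u = occurs-> u (n<1+n (maxVar u))

lam-∉ : ∀ x u → occurs x u ≡ false → lam x u ≡ K · u
lam-∉ x u x∉u rewrite x∉u = refl

lam-isVar : ∀ {x} v → isVar x v ≡ true → lam x v ≡ I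
lam-isVar (var y) v≡x rewrite v≡x = refl

[]-∉ : ∀ {x u} → occurs x u ≡ false → [ x ] u ≡ K · u
[]-∉ x∉u rewrite x∉u = refl

[]-η-clause : ∀ {x} u v → occurs x (u · v) ≡ true → isVar x v ∧ not (occurs x u) ≡ true →
              [ x ] (u · v) ≡ u
[]-η-clause u v x∈uv η rewrite x∈uv | η = refl

[]-S-clause : ∀ {x} u v → occurs x (u · v) ≡ true → isVar x v ∧ not (occurs x u) ≡ false →
              [ x ] (u · v) ≡ S · ([ x ] u) · ([ x ] v)
[]-S-clause u v x∈uv η rewrite x∈uv | η = refl

[]-η : ∀ {x t} → occurs x t ≡ false → [ x ] (t · var x) ≡ t
[]-η {x} {t} x∉t = []-η-clause t (var x) x∈tx η
  where
  x∈tx : occurs x (t · var x) ≡ true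
  x∈tx rewrite x∉t = ≡ᵇ-refl x
  η : isVar x (var x) ∧ not (occurs x t) ≡ true
  η rewrite x∉t | ≡ᵇ-refl x = refl

[]-S-η : ∀ {x a b} → occurs x a ≡ false → occurs x b ≡ false →
         [ x ] (a · var x · (b · var x)) ≡ S · a · b
[]-S-η {x} {a} {b} x∉a x∉b = begin
  [ x ] (a · var x · (b · var x))               ≡⟨ []-S-clause (a · var x) (b · var x) x∈ refl ⟩
  S · ([ x ] (a · var x)) · ([ x ] (b · var x)) ≡⟨ cong₂ (λ p q → S · p · q) ([]-η x∉a) ([]-η x∉b) ⟩
  S · a · b                                     ∎
  where
  open ≡-Reasoning
  x∈ : occurs x (a · var x · (b · var x)) ≡ true
  x∈ rewrite x∉a | ≡ᵇ-refl x = refl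

module Compatible (R : Rel Comb 0ℓ)
  (appL : ∀ {u u' v} → R u u' → R (u · v) (u' · v))
  (appR : ∀ {u v v'} → R v v' → R (u · v) (u · v')) where

  ·-congˡ : ∀ {u u' v} → EqClosure R u u' → EqClosure R (u · v) (u' · v)
  ·-congˡ {v = v} = gmap (_· v) appL

  ·-congʳ : ∀ {u v v'} → EqClosure R v v' → EqClosure R (u · v) (u · v')
  ·-congʳ {u} = gmap (u ·_) appR

  ·-cong : ∀ {u u' v v'} → EqClosure R u u' → EqClosure R v v' →
           EqClosure R (u · v) (u' · v')
  ·-cong p q = ·-congˡ p ◅◅ ·-congʳ q

  lam∼[] : (∀ t → EqClosure R (S · (K · t) · I) t) → ∀ x u → EqClosure R (lam x u) ([ x ] u)
  lam∼[] SKI∼ x u with occurs x u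
  ... | false = ε
  lam∼[] SKI∼ x (var y) | true = ε
  lam∼[] SKI∼ x K       | true = ε
  lam∼[] SKI∼ x S       | true = ε
  lam∼[] SKI∼ x I       | true = ε
  lam∼[] SKI∼ x (t · v) | true with isVar x v ∧ not (occurs x t) in η
  ... | true with ∧-not-true (isVar x v) (occurs x t) η
  ...   | v≡x , x∉t rewrite lam-∉ x t x∉t | lam-isVar v v≡x = SKI∼ t
  lam∼[] SKI∼ x (t · v) | true | false = ·-cong (·-cong ε (lam∼[] SKI∼ x t)) (lam∼[] SKI∼ x v)

module ≻-Compatible = Compatible _≻_ appL appR
module ⟶-Compatible = Compatible _⟶_ appL appR

lam≈[] : ∀ x u → lam x u ≈ [ x ] u
lam≈[] = ⟶-Compatible.lam∼[] (λ _ → return redSKI)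

≻⇒≈ : ∀ {u v} → u ≻ v → u ≈ v
≻⇒≈ redK     = return redK
≻⇒≈ redS     = return redS
≻⇒≈ redI     = return redI
≻⇒≈ (appL p) = ⟶-Compatible.·-congˡ (≻⇒≈ p)
≻⇒≈ (appR p) = ⟶-Compatible.·-congʳ (≻⇒≈ p)
≻⇒≈ (ξ {x} {u} {v} p) = begin
  [ x ] u ≈˘⟨ lam≈[] x u ⟩
  lam x u ≈⟨ gmap (lam x) ξ (≻⇒≈ p) ⟩
  lam x v ≈⟨ lam≈[] x v ⟩
  [ x ] v ∎
  where open SetoidReasoning (EqC.setoid _⟶_)

[]-≻ : ∀ x u {v} → u ≻ v → [ x ] u ≣ [ x ] v
[]-≻ x u p = return (ξ {x} {u} p)

SKI≣ : ∀ t → S · (K · t) · I ≣ t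
SKI≣ t = begin
  S · (K · t) · I                     ≡⟨ sym ([]-S-η x∉t refl) ⟩
  [ x ] (K · t · var x · (I · var x)) ≈⟨ []-≻ x (K · t · var x · (I · var x)) (appL redK) ⟩
  [ x ] (t · (I · var x))             ≈⟨ []-≻ x (t · (I · var x)) (appR redI) ⟩
  [ x ] (t · var x)                   ≡⟨ []-η x∉t ⟩
  t                                   ∎
  where
  open SetoidReasoning (EqC.setoid _≻_)
  x = fresh t
  x∉t = fresh-∉ t

SKK≣ : ∀ u v → S · (K · u) · (K · v) ≣ K · (u · v)
SKK≣ u v = begin
  S · (K · u) · (K · v)                   ≡⟨ sym ([]-S-η x∉u x∉v) ⟩
  [ x ] (K · u · var x · (K · v · var x)) ≈⟨ []-≻ x (K · u · var x · (K · v · var x)) (appL redK) ⟩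
  [ x ] (u · (K · v · var x))             ≈⟨ []-≻ x (u · (K · v · var x)) (appR redK) ⟩
  [ x ] (u · v)                           ≡⟨ []-∉ (fresh-∉ (u · v)) ⟩
  K · (u · v)                             ∎
  where
  open SetoidReasoning (EqC.setoid _≻_)
  x = fresh (u · v)
  x∉u = ∨-conicalˡ _ _ (fresh-∉ (u · v))
  x∉v = ∨-conicalʳ _ _ (fresh-∉ (u · v))

lam≣[] : ∀ x u → lam x u ≣ [ x ] u
lam≣[] = ≻-Compatible.lam∼[] SKI≣

⟶⇒≣ : ∀ {u v} → u ⟶ v → u ≣ v
⟶⇒≣ redK     = return redK
⟶⇒≣ redS     = return redS
⟶⇒≣ redI     = return redI
⟶⇒≣ redSKK   = SKK≣ _ _
⟶⇒≣ redSKI   = SKI≣ _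
⟶⇒≣ (appL p) = ≻-Compatible.·-congˡ (⟶⇒≣ p)
⟶⇒≣ (appR p) = ≻-Compatible.·-congʳ (⟶⇒≣ p)
⟶⇒≣ (ξ {x} {u} {v} p) = begin
  lam x u ≈⟨ lam≣[] x u ⟩
  [ x ] u ≈⟨ gmap ([ x ]_) ξ (⟶⇒≣ p) ⟩
  [ x ] v ≈˘⟨ lam≣[] x v ⟩
  lam x v ∎
  where open SetoidReasoning (EqC.setoid _≻_)

theorem2 : (u v : Comb) → (u ≣ v) ⇔ (u ≈ v)
theorem2 u v = mk⇔ (≻⇒≈ ⋆) (⟶⇒≣ ⋆)
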